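{- Let $a,b,c$ be integers and let $W:\mathbb{Z}^2\to\mathbb{Z}$ be the weight function of the network generated by $(a,b,c)$. Let $P,Q\in\mathbb{Z}^2$ be adjacent nodes, i.e. $Q-P\in\{(\pm1,0),(0,\pm1),(1,-1),(-1,1)\}$, and put $x=W(P)$, $y=W(Q)$. Then for every integer $k\ge0$, $W\big(P+k(Q-P)\big)=-(k-1)x+ky+k(k-1)$.
   Context: Let $\rho=e^{i\pi/3}$ and identify the node $m+n\rho$ of the triangular lattice with $(m,n)\in\mathbb{Z}^2$. The network generated by $(a,b,c)$ is the function $W:\mathbb{Z}^2\to\mathbb{Z}$ with $W(0,0)=a$, $W(1,0)=b$, $W(0,1)=c$, satisfying, for all $(m,n)\in\mathbb{Z}^2$, the lozenge rule (in every lozenge of two adjacent unit triangles, the weight sum on the long diagonal is $1$ more than on the short diagonal): $W(m,n)+W(m+1,n+1)=W(m+1,n)+W(m,n+1)+1$, $W(m+1,n)+W(m-1,n+1)=W(m,n)+W(m,n+1)+1$, $W(m,n+1)+W(m+1,n-1)=W(m,n)+W(m+1,n)+1$. Such a function exists and is unique. -}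

module Defs where

open import Data.Integer using (ℤ; +_; -_; _+_; _-_; _*_)
open import Data.Product using (_×_; _,_)
open import Data.Sum using (_⊎_)
open import Relation.Binary.PropositionalEquality using (_≡_)

-- Nodes m + nρ of the triangular lattice are pairs (m , n) ∈ ℤ².
Node : Set
Node = ℤ × ℤ

IsNetwork : ℤ → ℤ → ℤ → (ℤ → ℤ → ℤ) → Set
IsNetwork a b c W =
  W (+ 0) (+ 0) ≡ a × W (+ 1) (+ 0) ≡ b × W (+ 0) (+ 1) ≡ c ×
  (∀ m n → W m n + W (m + + 1) (n + + 1) ≡ W (m + + 1) n + W m (n + + 1) + + 1) ×
  (∀ m n → W (m + + 1) n + W (m - + 1) (n + + 1) ≡ W m n + W m (n + + 1) + + 1) ×
  (∀ m n → W m (n + + 1) + W (m + + 1) (n - + 1) ≡ W m n + W (m + + 1) n + + 1)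

IsUnitStep : ℤ → ℤ → Set
IsUnitStep d e =
  (d ≡ + 1 × e ≡ + 0) ⊎ (d ≡ - + 1 × e ≡ + 0) ⊎
  (d ≡ + 0 × e ≡ + 1) ⊎ (d ≡ + 0 × e ≡ - + 1) ⊎
  (d ≡ + 1 × e ≡ - + 1) ⊎ (d ≡ - + 1 × e ≡ + 1)

Adjacent : ℤ → ℤ → ℤ → ℤ → Set
Adjacent p₁ p₂ q₁ q₂ = IsUnitStep (q₁ - p₁) (q₂ - p₂)

-- Adding the two lozenge rules of a pair of lozenges that share a unit triangle gives the discrete
-- convexity relation W(P) + W(P + 2u) = 2 W(P + u) + 2 along every unit step u.  Hence
-- k ↦ W(P + k(Q − P)) satisfies a second-order linear recurrence, so it is determined by its values
-- x, y at k = 0, 1, and the quadratic −(k − 1)x + ky + k(k − 1) satisfies the same recurrence.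
module Submission where

open import Defs
open import Data.Integer using (ℤ; +_; -_; _+_; _-_; _*_)
open import Data.Integer.Properties using (+-comm; +-identityʳ; +-0-abelianGroup)
open import Algebra.Properties.AbelianGroup +-0-abelianGroup using ()
  renaming (∙-cancelˡ to +-cancelˡ-≡; ∙-cancelʳ to +-cancelʳ-≡)
open import Data.Integer.Tactic.RingSolver using (solve-∀)
open import Data.Nat using (ℕ; zero; suc)
open import Data.Product using (_×_; _,_; proj₁)
open import Data.Sum using (inj₁; inj₂)
open import Relation.Binary.PropositionalEquality using (_≡_; refl; sym; trans; cong; cong₂)
open Relation.Binary.PropositionalEquality.≡-Reasoning

HasSecondDifference : ℤ → (ℕ → ℤ) → Set
HasSecondDifference δ f = ∀ k → f k + f (suc (suc k)) ≡ f (suc k) + f (suc k) + δ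

secondDifference-unique : ∀ δ (f g : ℕ → ℤ) → HasSecondDifference δ f → HasSecondDifference δ g →
  f 0 ≡ g 0 → f 1 ≡ g 1 → ∀ k → f k ≡ g k
secondDifference-unique δ f g Δf Δg f₀≡g₀ f₁≡g₁ k = proj₁ (agree k)
  where
  agree : ∀ k → f k ≡ g k × f (suc k) ≡ g (suc k)
  agree zero = f₀≡g₀ , f₁≡g₁
  agree (suc k) with agree k
  ... | fₖ≡gₖ , fₖ₊₁≡gₖ₊₁ = fₖ₊₁≡gₖ₊₁ , +-cancelˡ-≡ (g k) _ _ (begin
    g k + f (suc (suc k))             ≡⟨ cong (_+ f (suc (suc k))) (sym fₖ≡gₖ) ⟩
    f k + f (suc (suc k))             ≡⟨ Δf k ⟩
    f (suc k) + f (suc k) + δ         ≡⟨ cong (λ z → z + z + δ) fₖ₊₁≡gₖ₊₁ ⟩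
    g (suc k) + g (suc k) + δ         ≡⟨ sym (Δg k) ⟩
    g k + g (suc (suc k))             ∎)

quadratic : ℤ → ℤ → ℤ → ℤ
quadratic x y k = - ((k - + 1) * x) + k * y + k * (k - + 1)

quadratic-step : ∀ x y k → quadratic x y k + quadratic x y (+ 2 + k)
                             ≡ quadratic x y (+ 1 + k) + quadratic x y (+ 1 + k) + + 2
quadratic-step = expanded
  where
  -- The ring solver does not unfold quadratic, so the identity is spelled out.
  expanded : ∀ x y k →
    (- ((k - + 1) * x) + k * y + k * (k - + 1))
      + (- ((+ 2 + k - + 1) * x) + (+ 2 + k) * y + (+ 2 + k) * (+ 2 + k - + 1))
    ≡ (- ((+ 1 + k - + 1) * x) + (+ 1 + k) * y + (+ 1 + k) * (+ 1 + k - + 1))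
      + (- ((+ 1 + k - + 1) * x) + (+ 1 + k) * y + (+ 1 + k) * (+ 1 + k - + 1)) + + 2
  expanded = solve-∀

quadratic-secondDifference : ∀ x y → HasSecondDifference (+ 2) (λ k → quadratic x y (+ k))
quadratic-secondDifference x y k = quadratic-step x y (+ k)

secondDifference-two⇒quadratic : ∀ f → HasSecondDifference (+ 2) f →
  ∀ k → f k ≡ quadratic (f 0) (f 1) (+ k)
secondDifference-two⇒quadratic f Δf =
  secondDifference-unique (+ 2) f (λ k → quadratic (f 0) (f 1) (+ k))
    Δf (quadratic-secondDifference (f 0) (f 1)) (sym (at-0 (f 0) (f 1))) (sym (at-1 (f 0) (f 1)))
  where
  at-0 : ∀ x y → - ((+ 0 - + 1) * x) + + 0 * y + + 0 * (+ 0 - + 1) ≡ x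
  at-0 = solve-∀
  at-1 : ∀ x y → - ((+ 1 - + 1) * x) + + 1 * y + + 1 * (+ 1 - + 1) ≡ y
  at-1 = solve-∀

SecondDifferenceTwoAlong : (ℤ → ℤ → ℤ) → ℤ → ℤ → Set
SecondDifferenceTwoAlong W d e =
  ∀ m n → W m n + W (m + d + d) (n + e + e) ≡ W (m + d) (n + e) + W (m + d) (n + e) + + 2

-- The lozenges with long diagonals a b and e d share the triangle b c d; adding them cancels b + d.
lozenge-pair : ∀ a b c d e → a + b ≡ c + d + + 1 → e + d ≡ c + b + + 1 → a + e ≡ c + c + + 2
lozenge-pair a b c d e ab ed = +-cancelʳ-≡ (b + d) _ _ (begin
  a + e + (b + d)               ≡⟨ regroup a b e d ⟩
  (a + b) + (e + d)             ≡⟨ cong₂ _+_ ab ed ⟩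
  (c + d + + 1) + (c + b + + 1) ≡⟨ collect c d b ⟩
  c + c + + 2 + (b + d)         ∎)
  where
  regroup : ∀ a b e d → a + e + (b + d) ≡ (a + b) + (e + d)
  regroup = solve-∀
  collect : ∀ c d b → (c + d + + 1) + (c + b + + 1) ≡ c + c + + 2 + (b + d)
  collect = solve-∀

swap-summands : ∀ {x} u v → x ≡ u + v + + 1 → x ≡ v + u + + 1
swap-summands u v x≡ = trans x≡ (cong (_+ + 1) (+-comm u v))

secondDifferenceTwoAlong-neg : ∀ {W} d e →
  SecondDifferenceTwoAlong W d e → SecondDifferenceTwoAlong W (- d) (- e)
secondDifferenceTwoAlong-neg {W} d e Δ m n = begin
  W m n + W (m + - d + - d) (n + - e + - e)
    ≡⟨ +-comm (W m n) _ ⟩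
  W m′ n′ + W m n
    ≡⟨ cong₂ (λ i j → W m′ n′ + W i j) (sym (back-twice m d)) (sym (back-twice n e)) ⟩
  W m′ n′ + W (m′ + d + d) (n′ + e + e)
    ≡⟨ Δ m′ n′ ⟩
  W (m′ + d) (n′ + e) + W (m′ + d) (n′ + e) + + 2
    ≡⟨ cong₂ (λ i j → W i j + W i j + + 2) (back-once m d) (back-once n e) ⟩
  W (m + - d) (n + - e) + W (m + - d) (n + - e) + + 2 ∎
  where
  m′ = m + - d + - d
  n′ = n + - e + - e
  back-twice : ∀ m d → m + - d + - d + d + d ≡ m
  back-twice = solve-∀
  back-once : ∀ m d → m + - d + - d + d ≡ m + - d
  back-once = solve-∀

module Lozenges (W : ℤ → ℤ → ℤ)
  (lozenge₁ : ∀ m n → W m n + W (m + + 1) (n + + 1) ≡ W (m + + 1) n + W m (n + + 1) + + 1)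
  (lozenge₂ : ∀ m n → W (m + + 1) n + W (m - + 1) (n + + 1) ≡ W m n + W m (n + + 1) + + 1)
  (lozenge₃ : ∀ m n → W m (n + + 1) + W (m + + 1) (n - + 1) ≡ W m n + W (m + + 1) n + + 1)
  where

  private
    +1-1 : ∀ m → m + + 1 - + 1 ≡ m
    +1-1 = solve-∀
    -1+1 : ∀ m → m - + 1 + + 1 ≡ m
    -1+1 = solve-∀

  secondDifferenceTwoAlong-10 : SecondDifferenceTwoAlong W (+ 1) (+ 0)
  secondDifferenceTwoAlong-10 m n rewrite +-identityʳ n | +-identityʳ n =
    lozenge-pair (W m n) (W m₁ n₁) (W m₁ n) (W m n₁) (W (m₁ + + 1) n)
      (lozenge₁ m n)
      (trans (cong (λ i → W (m₁ + + 1) n + W i n₁) (sym (+1-1 m))) (lozenge₂ m₁ n))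
    where
    m₁ = m + + 1
    n₁ = n + + 1

  secondDifferenceTwoAlong-01 : SecondDifferenceTwoAlong W (+ 0) (+ 1)
  secondDifferenceTwoAlong-01 m n rewrite +-identityʳ m | +-identityʳ m =
    lozenge-pair (W m n) (W m₁ n₁) (W m n₁) (W m₁ n) (W m (n₁ + + 1))
      (swap-summands (W m₁ n) (W m n₁) (lozenge₁ m n))
      (trans (cong (λ j → W m (n₁ + + 1) + W m₁ j) (sym (+1-1 n))) (lozenge₃ m n₁))
    where
    m₁ = m + + 1
    n₁ = n + + 1

  secondDifferenceTwoAlong-1-1 : SecondDifferenceTwoAlong W (+ 1) (- + 1)
  secondDifferenceTwoAlong-1-1 m n =
    lozenge-pair (W m n) (W m₁ (n₁ - + 1)) (W m₁ n₁) (W m n₁) (W (m₁ + + 1) (n₁ - + 1))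
      (swap-summands (W m n₁) (W m₁ n₁) lower)
      (swap-summands (W m₁ (n₁ - + 1)) (W m₁ n₁) upper)
    where
    m₁ = m + + 1
    n₁ = n - + 1
    lower : W m n + W m₁ (n₁ - + 1) ≡ W m n₁ + W m₁ n₁ + + 1
    lower with lozenge₃ m n₁
    ... | l rewrite -1+1 n = l
    upper : W (m₁ + + 1) (n₁ - + 1) + W m n₁ ≡ W m₁ (n₁ - + 1) + W m₁ n₁ + + 1
    upper with lozenge₂ m₁ (n₁ - + 1)
    ... | l rewrite +1-1 m | -1+1 n₁ = l

  secondDifferenceTwoAlong-unitStep : ∀ {d e} → IsUnitStep d e → SecondDifferenceTwoAlong W d e
  secondDifferenceTwoAlong-unitStep (inj₁ (refl , refl)) = secondDifferenceTwoAlong-10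
  secondDifferenceTwoAlong-unitStep (inj₂ (inj₁ (refl , refl))) =
    secondDifferenceTwoAlong-neg {W} _ _ secondDifferenceTwoAlong-10
  secondDifferenceTwoAlong-unitStep (inj₂ (inj₂ (inj₁ (refl , refl)))) = secondDifferenceTwoAlong-01
  secondDifferenceTwoAlong-unitStep (inj₂ (inj₂ (inj₂ (inj₁ (refl , refl))))) =
    secondDifferenceTwoAlong-neg {W} _ _ secondDifferenceTwoAlong-01
  secondDifferenceTwoAlong-unitStep (inj₂ (inj₂ (inj₂ (inj₂ (inj₁ (refl , refl)))))) = secondDifferenceTwoAlong-1-1
  secondDifferenceTwoAlong-unitStep (inj₂ (inj₂ (inj₂ (inj₂ (inj₂ (refl , refl)))))) =
    secondDifferenceTwoAlong-neg {W} _ _ secondDifferenceTwoAlong-1-1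

secondDifferenceTwoAlong⇒ray : ∀ {W} d e → SecondDifferenceTwoAlong W d e →
  ∀ p₁ p₂ → HasSecondDifference (+ 2) (λ k → W (p₁ + + k * d) (p₂ + + k * e))
secondDifferenceTwoAlong⇒ray {W} d e Δ p₁ p₂ k = begin
  W m n + W (p₁ + + suc (suc k) * d) (p₂ + + suc (suc k) * e)
    ≡⟨ cong (λ z → W m n + z) (sym (cong₂ W (two-steps p₁ (+ k) d) (two-steps p₂ (+ k) e))) ⟩
  W m n + W (m + d + d) (n + e + e)
    ≡⟨ Δ m n ⟩
  W (m + d) (n + e) + W (m + d) (n + e) + + 2
    ≡⟨ cong₂ (λ i j → W i j + W i j + + 2) (one-step p₁ (+ k) d) (one-step p₂ (+ k) e) ⟩
  W (p₁ + + suc k * d) (p₂ + + suc k * e) + W (p₁ + + suc k * d) (p₂ + + suc k * e) + + 2 ∎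
  where
  m = p₁ + + k * d
  n = p₂ + + k * e
  one-step : ∀ p k u → p + k * u + u ≡ p + (+ 1 + k) * u
  one-step = solve-∀
  two-steps : ∀ p k u → p + k * u + u + u ≡ p + (+ 2 + k) * u
  two-steps = solve-∀

lemma5p2 : (a b c : ℤ) (W : ℤ → ℤ → ℤ) → IsNetwork a b c W →
    (p₁ p₂ q₁ q₂ : ℤ) → Adjacent p₁ p₂ q₁ q₂ → (k : ℕ) →
      W (p₁ + + k * (q₁ - p₁)) (p₂ + + k * (q₂ - p₂))
        ≡ - ((+ k - + 1) * W p₁ p₂) + + k * W q₁ q₂ + + k * (+ k - + 1)
lemma5p2 a b c W (_ , _ , _ , lozenge₁ , lozenge₂ , lozenge₃) p₁ p₂ q₁ q₂ adjacent k = begin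
  f k                                  ≡⟨ secondDifference-two⇒quadratic f Δf k ⟩
  quadratic (f 0) (f 1) (+ k)          ≡⟨ cong₂ (λ x y → quadratic x y (+ k)) f₀ f₁ ⟩
  quadratic (W p₁ p₂) (W q₁ q₂) (+ k)  ∎
  where
  open Lozenges W lozenge₁ lozenge₂ lozenge₃
  f : ℕ → ℤ
  f k = W (p₁ + + k * (q₁ - p₁)) (p₂ + + k * (q₂ - p₂))
  Δf : HasSecondDifference (+ 2) f
  Δf = secondDifferenceTwoAlong⇒ray {W} (q₁ - p₁) (q₂ - p₂)
         (secondDifferenceTwoAlong-unitStep adjacent) p₁ p₂
  no-step : ∀ p u → p + + 0 * u ≡ p
  no-step = solve-∀
  full-step : ∀ p q → p + + 1 * (q - p) ≡ q
  full-step = solve-∀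
  f₀ : f 0 ≡ W p₁ p₂
  f₀ = cong₂ W (no-step p₁ (q₁ - p₁)) (no-step p₂ (q₂ - p₂))
  f₁ : f 1 ≡ W q₁ q₂
  f₁ = cong₂ W (full-step p₁ q₁) (full-step p₂ q₂)
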